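{- Let $k_i,\ell_i$ ($1\leq i\leq m$), $b$, $n_1$, $n_2$ be positive integers with $k_i,\ell_i\leq b$ for all $i$, $9b^2<n_1$ and $9b^2<n_2$. For each $i$ let $\mathcal{R}_i$ be a family of $k_i\times\ell_i$ rectangles in $\mathbb{Z}_{n_1}\times\mathbb{Z}_{n_2}$, and suppose $\mathcal{R}=\bigcup_{i=1}^m\mathcal{R}_i$ is proj-intersecting. Then either $|\mathcal{R}_i|\leq \ell_i n_1$ holds for all $i$ ($1\leq i\leq m$), or $|\mathcal{R}_i|\leq k_i n_2$ holds for all $i$ ($1\leq i\leq m$).
   Context: An interval of length $a$ in $\mathbb{Z}_n$ is a set $\{i+1,\ldots,i+a\}$ (mod $n$). A $k\times\ell$ rectangle in $\mathbb{Z}_{n_1}\times\mathbb{Z}_{n_2}$ is $I\times J$ with $I$ an interval of length $k$ in $\mathbb{Z}_{n_1}$ and $J$ an interval of length $\ell$ in $\mathbb{Z}_{n_2}$. Rectangles $I\times J$, $I'\times J'$ are proj-intersecting if $I\cap I'\neq\emptyset$ or $J\cap J'\neq\emptyset$; a family is proj-intersecting if every two members are. -}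

module Defs where

open import Data.Nat using (ℕ; suc; _+_; _<_; NonZero)
open import Data.Nat.DivMod using (_%_)
open import Data.Fin using (Fin; toℕ)
open import Data.Product using (Σ; _×_; _,_)
open import Data.Sum using (_⊎_)
open import Relation.Binary.PropositionalEquality using (_≡_)

InInterval : (n : ℕ) .{{_ : NonZero n}} → (a : ℕ) → Fin n → Fin n → Set
InInterval n a s x = Σ ℕ λ j → j < a × toℕ x ≡ (toℕ s + suc j) % n

IntervalsMeet : (n : ℕ) .{{_ : NonZero n}} → (a : ℕ) → Fin n → (a' : ℕ) → Fin n → Set
IntervalsMeet n a s a' s' = Σ (Fin n) λ x → InInterval n a s x × InInterval n a' s' x

-- A k×ℓ rectangle I×J in ℤ_{n₁}×ℤ_{n₂} is given by the pair of starting
-- points (i, j): I = {i+1,…,i+k}, J = {j+1,…,j+ℓ}.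
Rect : ℕ → ℕ → Set
Rect n₁ n₂ = Fin n₁ × Fin n₂

ProjIntersecting : (n₁ n₂ : ℕ) .{{_ : NonZero n₁}} .{{_ : NonZero n₂}} →
                   (k ℓ : ℕ) → Rect n₁ n₂ → (k' ℓ' : ℕ) → Rect n₁ n₂ → Set
ProjIntersecting n₁ n₂ k ℓ (i , j) k' ℓ' (i' , j') =
  IntervalsMeet n₁ k i k' i' ⊎ IntervalsMeet n₂ ℓ j ℓ' j'

-- If a proj-intersecting family of k × ℓ rectangles has no row containing two rectangles whose
-- J-intervals are at cyclic distance ≥ L, then every row has at most 2L members; moreover either all
-- J-intervals within each row pairwise meet (Katona's circle bound: at most ℓ per row), or some row
-- holds two disjoint J-intervals, which pushes every row whose I-interval misses it below ℓ; as n₁ is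
-- large the few remaining rows do not matter.  Either way the family has at most ℓ n₁ members.
-- So if |R_i| > ℓ_i n₁ and |R_j| > k_j n₂, then R_i has a row with two J-intervals at distance
-- ≥ ℓ_i + ℓ_j and, transposing, R_j has a column with two I-intervals at distance ≥ k_j + k_i.
-- No rectangle of that column J-meets both rectangles of that row (their J-intervals would be within
-- ℓ_i + ℓ_j of each other), so both rectangles of the column I-meet the row's I-interval, and their
-- I-intervals are within k_j + k_i of each other — a contradiction.

module Submission where

open import Defs
open import Data.Nat using (ℕ; suc; _+_; _*_; _∸_; _≤_; _<_; _≤?_; _<?_; z≤n; s≤s; pred; NonZero)
open import Data.Nat.Base using (>-nonZero; >-nonZero⁻¹)
open import Data.Nat.Properties
open import Data.Nat.DivMod
open import Data.Nat.ListAction using (sum)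
open import Data.Nat.Solver using (module +-*-Solver)
open import Data.Fin using (Fin; toℕ; fromℕ<) renaming (zero to fzero; suc to fsuc)
open import Data.Fin.Properties using (all?; ¬∀⟶∃¬; toℕ<n; toℕ-injective; toℕ-fromℕ<; pigeonhole)
  renaming (_≟_ to _≟ᶠ_)
open import Data.List using (List; []; _∷_; length; map; lookup; filter; allFin)
open import Data.List.Properties using (length-tabulate; length-map)
open import Data.List.Membership.Propositional using (_∈_; find)
open import Data.List.Membership.Propositional.Properties using (∈-lookup; ∈-allFin; ∈-filter⁻; ∈-map⁻)
open import Data.List.Relation.Unary.Unique.Propositional.Properties using (allFin⁺; filter⁺; map⁺)
open import Data.List.Relation.Unary.Any using (here; there)
import Data.List.Relation.Unary.All as All
open import Data.List.Relation.Unary.All.Properties using (¬All⇒Any¬)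
open import Data.List.Relation.Unary.Unique.Propositional using (Unique)
open import Data.List.Relation.Unary.AllPairs using ([]; _∷_)
open import Data.Product using (∃; ∃₂; _×_; _,_; proj₁; proj₂; swap)
open import Data.Sum using (_⊎_; inj₁; inj₂)
import Data.Sum as Sum
open import Function using (_∘_; id; flip)
open import Level using (0ℓ)
open import Relation.Nullary using (¬_; yes; no; Dec; contradiction)
open import Relation.Nullary.Decidable using (_⊎-dec_; _→-dec_)
open import Relation.Unary using (Pred; Decidable)
open import Relation.Binary using (DecidableEquality)
open import Relation.Binary.PropositionalEquality

lookup-injective : {A : Set} {xs : List A} → Unique xs → ∀ i j → lookup xs i ≡ lookup xs j → i ≡ j
lookup-injective (_ ∷ _)      fzero    fzero    _  = refl
lookup-injective (x∉xs ∷ _)   fzero    (fsuc j) eq = contradiction eq (All.lookup x∉xs (∈-lookup j))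
lookup-injective (x∉xs ∷ _)   (fsuc i) fzero    eq = contradiction (sym eq) (All.lookup x∉xs (∈-lookup i))
lookup-injective (_ ∷ unique) (fsuc i) (fsuc j) eq = cong fsuc (lookup-injective unique i j eq)

length≤-by-injection : {A : Set} {xs : List A} → Unique xs → (φ : A → ℕ) {K : ℕ} →
                       (∀ {x} → x ∈ xs → φ x < K) →
                       (∀ {x y} → x ∈ xs → y ∈ xs → φ x ≡ φ y → x ≡ y) →
                       length xs ≤ K
length≤-by-injection {xs = xs} unique φ {K} φ<K φ-inj with length xs ≤? K
... | yes ≤K = ≤K
... | no ≰K with i , j , i<j , eq ← pigeonhole (≰⇒> ≰K) (λ i → fromℕ< (φ<K (∈-lookup i)))
  = contradiction (lookup-injective unique i j (φ-inj (∈-lookup i) (∈-lookup j) φ-eq)) (<⇒≢ i<j ∘ cong toℕ)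
  where
  φ-eq : φ (lookup xs i) ≡ φ (lookup xs j)
  φ-eq = trans (sym (toℕ-fromℕ< _)) (trans (cong toℕ eq) (toℕ-fromℕ< _))

length≤-by-piecewise-injection :
  {A : Set} {xs : List A} → Unique xs → {P : Pred A 0ℓ} → Decidable P → (f g : A → ℕ) {K : ℕ} →
  (∀ {x} → x ∈ xs → P x → f x < K) → (∀ {x} → x ∈ xs → ¬ P x → g x < K) →
  (∀ {x y} → x ∈ xs → y ∈ xs → P x → P y → f x ≡ f y → x ≡ y) →
  (∀ {x y} → x ∈ xs → y ∈ xs → ¬ P x → ¬ P y → g x ≡ g y → x ≡ y) →
  (∀ {x y} → x ∈ xs → y ∈ xs → P x → ¬ P y → f x ≢ g y) →
  length xs ≤ K
length≤-by-piecewise-injection {A} {xs} unique {P} P? f g {K} f<K g<K f-inj g-inj f≢g =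
  length≤-by-injection unique φ φ<K φ-inj
  where
  φ : A → ℕ
  φ x with P? x
  ... | yes _ = f x
  ... | no _  = g x
  φ<K : ∀ {x} → x ∈ xs → φ x < K
  φ<K {x} x∈ with P? x
  ... | yes px = f<K x∈ px
  ... | no ¬px = g<K x∈ ¬px
  φ-inj : ∀ {x y} → x ∈ xs → y ∈ xs → φ x ≡ φ y → x ≡ y
  φ-inj {x} {y} x∈ y∈ eq with P? x | P? y
  ... | yes px  | yes py  = f-inj x∈ y∈ px py eq
  ... | no ¬px  | no ¬py  = g-inj x∈ y∈ ¬px ¬py eq
  ... | yes px  | no ¬py  = contradiction eq (f≢g x∈ y∈ px ¬py)
  ... | no ¬px  | yes py  = contradiction (sym eq) (f≢g y∈ x∈ py ¬px)

module _ {A : Set} where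

  sum-map-mono : {f g : A → ℕ} → (∀ x → f x ≤ g x) → ∀ xs → sum (map f xs) ≤ sum (map g xs)
  sum-map-mono f≤g []       = z≤n
  sum-map-mono f≤g (x ∷ xs) = +-mono-≤ (f≤g x) (sum-map-mono f≤g xs)

  sum-map-mono-< : {f g : A → ℕ} → (∀ x → f x ≤ g x) → ∀ {a xs} → a ∈ xs → f a < g a →
                   sum (map f xs) < sum (map g xs)
  sum-map-mono-< f≤g {xs = x ∷ xs} (here refl) fa<ga = +-mono-<-≤ fa<ga (sum-map-mono f≤g xs)
  sum-map-mono-< f≤g {xs = x ∷ xs} (there a∈) fa<ga = +-mono-≤-< (f≤g x) (sum-map-mono-< f≤g a∈ fa<ga)

  sum-map-≤-* : {f : A → ℕ} {y : ℕ} → (∀ x → f x ≤ y) → ∀ xs → sum (map f xs) ≤ y * length xs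
  sum-map-≤-* f≤y []       = z≤n
  sum-map-≤-* {y = y} f≤y (x ∷ xs) =
    ≤-trans (+-mono-≤ (f≤y x) (sum-map-≤-* f≤y xs)) (≤-reflexive (sym (*-suc y (length xs))))

  sum-map-≤-piecewise : {P : Pred A 0ℓ} (P? : Decidable P) {f : A → ℕ} {y z : ℕ} →
                        (∀ x → P x → f x ≤ y + z) → (∀ x → ¬ P x → f x ≤ y) →
                        ∀ xs → sum (map f xs) ≤ y * length xs + z * length (filter P? xs)
  sum-map-≤-piecewise P? ≤P ≤¬P [] = z≤n
  sum-map-≤-piecewise P? {f} {y} {z} ≤P ≤¬P (x ∷ xs) with P? x
  ... | yes px = ≤-trans (+-mono-≤ (≤P x px) ih) (≤-reflexive (rearrange y z _ _))
    where
    open +-*-Solver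
    ih = sum-map-≤-piecewise P? ≤P ≤¬P xs
    rearrange : ∀ y z l m → y + z + (y * l + z * m) ≡ y * suc l + z * suc m
    rearrange = solve 4 (λ y z l m → y :+ z :+ (y :* l :+ z :* m) := y :* (con 1 :+ l) :+ z :* (con 1 :+ m)) refl
  ... | no ¬px = ≤-trans (+-mono-≤ (≤¬P x ¬px) ih) (≤-reflexive (rearrange y z _ _))
    where
    open +-*-Solver
    ih = sum-map-≤-piecewise P? ≤P ≤¬P xs
    rearrange : ∀ y z l m → y + (y * l + z * m) ≡ y * suc l + z * m
    rearrange = solve 4 (λ y z l m → y :+ (y :* l :+ z :* m) := y :* (con 1 :+ l) :+ z :* m) refl

module Rows {A B : Set} (_≟_ : DecidableEquality A) where

  row : A → List (A × B) → List B
  row a [] = []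
  row a ((a' , b) ∷ xs) with a' ≟ a
  ... | yes _ = b ∷ row a xs
  ... | no _  = row a xs

  ∈-row⁻ : ∀ {a b} xs → b ∈ row a xs → (a , b) ∈ xs
  ∈-row⁻ {a} ((a' , b') ∷ xs) b∈ with a' ≟ a
  ∈-row⁻ ((a' , b') ∷ xs) (here refl) | yes refl = here refl
  ∈-row⁻ ((a' , b') ∷ xs) (there b∈)  | yes refl = there (∈-row⁻ xs b∈)
  ∈-row⁻ ((a' , b') ∷ xs) b∈          | no _     = there (∈-row⁻ xs b∈)

  row-unique : ∀ {a} {xs} → Unique xs → Unique (row a xs)
  row-unique {xs = []} _ = []
  row-unique {a} {(a' , b) ∷ xs} (x∉xs ∷ unique) with a' ≟ a
  ... | yes refl = All.tabulate (λ b'∈ b≡b' → All.lookup x∉xs (∈-row⁻ xs b'∈) (cong (a' ,_) b≡b'))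
                   ∷ row-unique unique
  ... | no _ = row-unique unique

  length-row-∷ : ∀ a x xs → length (row a xs) ≤ length (row a (x ∷ xs))
  length-row-∷ a (a' , b) xs with a' ≟ a
  ... | yes _ = n≤1+n _
  ... | no _  = ≤-refl

  length-row-∷-< : ∀ a b xs → length (row a xs) < length (row a ((a , b) ∷ xs))
  length-row-∷-< a b xs with a ≟ a
  ... | yes _  = ≤-refl
  ... | no a≢a = contradiction refl a≢a

  length≤sum-rows : ∀ {as} xs → (∀ {x} → x ∈ xs → proj₁ x ∈ as) →
                    length xs ≤ sum (map (λ a → length (row a xs)) as)
  length≤sum-rows []               _     = z≤n
  length≤sum-rows ((a , b) ∷ xs) ∈as =
    <-≤-trans (s≤s (length≤sum-rows xs (∈as ∘ there)))
              (sum-map-mono-< (λ a' → length-row-∷ a' (a , b) xs) (∈as (here refl)) (length-row-∷-< a b xs))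

  private
    sameRow⇒? : {Q : B → B → Set} → (∀ b b' → Dec (Q b b')) →
                ∀ x y → Dec (proj₁ x ≡ proj₁ y → Q (proj₂ x) (proj₂ y))
    sameRow⇒? Q? (a , b) (a' , b') = (a ≟ a') →-dec Q? b b'

  sameRow-or-counterexample :
    {Q : B → B → Set} → (∀ b b' → Dec (Q b b')) → (xs : List (A × B)) →
    (∀ {a b b'} → (a , b) ∈ xs → (a , b') ∈ xs → Q b b') ⊎
    (∃ λ a → ∃₂ λ b b' → (a , b) ∈ xs × (a , b') ∈ xs × ¬ Q b b')
  sameRow-or-counterexample Q? xs with All.all? (λ x → All.all? (sameRow⇒? Q? x) xs) xs
  ... | yes all = inj₁ (λ x∈ y∈ → All.lookup (All.lookup all x∈) y∈ refl)
  ... | no ¬all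
    with (a , b) , x∈ , ¬allx ← find (¬All⇒Any¬ (λ x → All.all? (sameRow⇒? Q? x) xs) xs ¬all)
    with (a' , b') , y∈ , ¬q ← find (¬All⇒Any¬ (sameRow⇒? Q? (a , b)) xs ¬allx)
    with a ≟ a'
  ... | yes refl = inj₂ (a , b , b' , x∈ , y∈ , λ q → ¬q (λ _ → q))
  ... | no a≢a'  = contradiction (λ a≡a' → contradiction a≡a' a≢a') ¬q

IntervalsMeet-sym : ∀ {n} .{{_ : NonZero n}} {a s a' s'} → IntervalsMeet n a s a' s' → IntervalsMeet n a' s' a s
IntervalsMeet-sym (x , x∈ , x∈') = x , x∈' , x∈

module Cyclic (n : ℕ) .{{_ : NonZero n}} where
  open ≡-Reasoning

  infix 4 _≈_
  _≈_ : ℕ → ℕ → Set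
  x ≈ y = x % n ≡ y % n

  %-≈ : ∀ x → x % n ≈ x
  %-≈ x = m%n%n≡m%n x n

  ≈-+ʳ : ∀ {x y} z → x ≈ y → x + z ≈ y + z
  ≈-+ʳ {x} {y} z x≈y = begin
    (x + z) % n           ≡⟨ %-distribˡ-+ x z n ⟩
    (x % n + z % n) % n   ≡⟨ cong (λ w → (w + z % n) % n) x≈y ⟩
    (y % n + z % n) % n   ≡⟨ %-distribˡ-+ y z n ⟨
    (y + z) % n           ∎

  -- Adding z * pred n to x + z gives x + z * n, which is ≈ x.
  ≈-cancelʳ-+ : ∀ {x y} z → x + z ≈ y + z → x ≈ y
  ≈-cancelʳ-+ {x} {y} z x+z≈y+z = begin
    x % n                         ≡⟨ [m+kn]%n≡m%n x z n ⟨
    (x + z * n) % n               ≡⟨ cong (_% n) (shift x) ⟩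
    (x + z + z * pred n) % n      ≡⟨ ≈-+ʳ (z * pred n) x+z≈y+z ⟩
    (y + z + z * pred n) % n      ≡⟨ cong (_% n) (shift y) ⟨
    (y + z * n) % n               ≡⟨ [m+kn]%n≡m%n y z n ⟩
    y % n                         ∎
    where
    shift : ∀ w → w + z * n ≡ w + z + z * pred n
    shift w = begin
      w + z * n                ≡⟨ cong (λ m → w + z * m) (suc-pred n) ⟨
      w + z * suc (pred n)     ≡⟨ cong (w +_) (*-suc z (pred n)) ⟩
      w + (z + z * pred n)     ≡⟨ +-assoc w z _ ⟨
      w + z + z * pred n       ∎

  ≈⇒≡ : ∀ {x y} → x < n → y < n → x ≈ y → x ≡ y
  ≈⇒≡ x<n y<n x≈y = trans (sym (m<n⇒m%n≡m x<n)) (trans x≈y (m<n⇒m%n≡m y<n))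

  toℕ-≈-injective : ∀ {a b : Fin n} → toℕ a ≈ toℕ b → a ≡ b
  toℕ-≈-injective {a} {b} = toℕ-injective ∘ ≈⇒≡ (toℕ<n a) (toℕ<n b)

  -- δ a b is the forward distance from a to b, the representative of b − a in [0, n).
  opaque
    δ : Fin n → Fin n → ℕ
    δ a b = (toℕ b + (n ∸ toℕ a)) % n

    δ<n : ∀ a b → δ a b < n
    δ<n a b = m%n<n _ n

    +δ≈ : ∀ a b → toℕ a + δ a b ≈ toℕ b
    +δ≈ a b = begin
      (toℕ a + δ a b) % n                     ≡⟨ cong (_% n) (+-comm (toℕ a) _) ⟩
      (δ a b + toℕ a) % n                     ≡⟨ ≈-+ʳ (toℕ a) (%-≈ _) ⟩
      (toℕ b + (n ∸ toℕ a) + toℕ a) % n       ≡⟨ cong (_% n) (+-assoc (toℕ b) _ _) ⟩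
      (toℕ b + ((n ∸ toℕ a) + toℕ a)) % n     ≡⟨ cong (λ m → (toℕ b + m) % n) (m∸n+n≡m (<⇒≤ (toℕ<n a))) ⟩
      (toℕ b + n) % n                         ≡⟨ [m+n]%n≡m%n (toℕ b) n ⟩
      toℕ b % n                               ∎

  δ-unique : ∀ {a b d} → toℕ a + d ≈ toℕ b → δ a b ≡ d % n
  δ-unique {a} {b} {d} a+d≈b = begin
    δ a b                 ≡⟨ m<n⇒m%n≡m (δ<n a b) ⟨
    δ a b % n             ≡⟨ ≈-cancelʳ-+ (toℕ a) (begin
      (δ a b + toℕ a) % n   ≡⟨ cong (_% n) (+-comm _ (toℕ a)) ⟩
      (toℕ a + δ a b) % n   ≡⟨ trans (+δ≈ a b) (sym a+d≈b) ⟩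
      (toℕ a + d) % n       ≡⟨ cong (_% n) (+-comm (toℕ a) d) ⟩
      (d + toℕ a) % n       ∎) ⟩
    d % n                 ∎

  δ≤ : ∀ {a b d} → toℕ a + d ≈ toℕ b → δ a b ≤ d
  δ≤ {d = d} a+d≈b = subst (_≤ d) (sym (δ-unique a+d≈b)) (m%n≤m d n)

  δ-exact : ∀ {a b d} → toℕ a + d ≈ toℕ b → d < n → δ a b ≡ d
  δ-exact a+d≈b d<n = trans (δ-unique a+d≈b) (m<n⇒m%n≡m d<n)

  +δ+δ≈ : ∀ a b c → toℕ a + (δ a b + δ b c) ≈ toℕ c
  +δ+δ≈ a b c = begin
    (toℕ a + (δ a b + δ b c)) % n   ≡⟨ cong (_% n) (+-assoc (toℕ a) _ _) ⟨
    (toℕ a + δ a b + δ b c) % n     ≡⟨ ≈-+ʳ (δ b c) (+δ≈ a b) ⟩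
    (toℕ b + δ b c) % n             ≡⟨ +δ≈ b c ⟩
    toℕ c % n                       ∎

  δ-triangle : ∀ a b c → δ a c ≤ δ a b + δ b c
  δ-triangle a b c = δ≤ (+δ+δ≈ a b c)

  δ-+ : ∀ {a b c} → δ a b + δ b c < n → δ a c ≡ δ a b + δ b c
  δ-+ {a} {b} {c} = δ-exact (+δ+δ≈ a b c)

  δ-self : ∀ a → δ a a ≡ 0
  δ-self a = δ-exact (cong (_% n) (+-identityʳ (toℕ a))) (>-nonZero⁻¹ n)

  δ≡0⇒≡ : ∀ {a b} → δ a b ≡ 0 → a ≡ b
  δ≡0⇒≡ {a} {b} δ≡0 = toℕ-≈-injective (begin
    toℕ a % n             ≡⟨ cong (_% n) (+-identityʳ (toℕ a)) ⟨
    (toℕ a + 0) % n       ≡⟨ cong (λ d → (toℕ a + d) % n) δ≡0 ⟨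
    (toℕ a + δ a b) % n   ≡⟨ +δ≈ a b ⟩
    toℕ b % n             ∎)

  δ-∸ˡ : ∀ {a b c} → δ a b ≤ δ a c → δ b c ≡ δ a c ∸ δ a b
  δ-∸ˡ {a} {b} {c} ab≤ac = δ-exact (begin
    (toℕ b + (δ a c ∸ δ a b)) % n            ≡⟨ ≈-+ʳ (δ a c ∸ δ a b) (+δ≈ a b) ⟨
    (toℕ a + δ a b + (δ a c ∸ δ a b)) % n    ≡⟨ cong (_% n) (+-assoc (toℕ a) _ _) ⟩
    (toℕ a + (δ a b + (δ a c ∸ δ a b))) % n  ≡⟨ cong (λ d → (toℕ a + d) % n) (m+[n∸m]≡n ab≤ac) ⟩
    (toℕ a + δ a c) % n                      ≡⟨ +δ≈ a c ⟩
    toℕ c % n                                ∎) (≤-<-trans (m∸n≤m (δ a c) (δ a b)) (δ<n a c))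

  δ-∸ʳ : ∀ {a b c} → δ b c ≤ δ a c → δ a b ≡ δ a c ∸ δ b c
  δ-∸ʳ {a} {b} {c} bc≤ac = δ-exact (≈-cancelʳ-+ (δ b c) (begin
    (toℕ a + (δ a c ∸ δ b c) + δ b c) % n    ≡⟨ cong (_% n) (+-assoc (toℕ a) _ _) ⟩
    (toℕ a + ((δ a c ∸ δ b c) + δ b c)) % n  ≡⟨ cong (λ d → (toℕ a + d) % n) (m∸n+n≡m bc≤ac) ⟩
    (toℕ a + δ a c) % n                      ≡⟨ trans (+δ≈ a c) (sym (+δ≈ b c)) ⟩
    (toℕ b + δ b c) % n                      ∎)) (≤-<-trans (m∸n≤m (δ a c) (δ b c)) (δ<n a c))

  δ-∸ˡ-≤ : ∀ {a b c} → δ a b ≤ δ a c → δ b c ≤ δ a c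
  δ-∸ˡ-≤ {a} {b} {c} ab≤ac = ≤-trans (≤-reflexive (δ-∸ˡ ab≤ac)) (m∸n≤m (δ a c) (δ a b))

  δ-∸ʳ-≤ : ∀ {a b c} → δ b c ≤ δ a c → δ a b ≤ δ a c
  δ-∸ʳ-≤ {a} {b} {c} bc≤ac = ≤-trans (≤-reflexive (δ-∸ʳ bc≤ac)) (m∸n≤m (δ a c) (δ b c))

  δ-injectiveʳ : ∀ {a b c} → δ a b ≡ δ a c → b ≡ c
  δ-injectiveʳ {a} {b} {c} eq = δ≡0⇒≡ (begin
    δ b c            ≡⟨ δ-∸ˡ (≤-reflexive eq) ⟩
    δ a c ∸ δ a b    ≡⟨ cong (_∸ δ a b) eq ⟨
    δ a b ∸ δ a b    ≡⟨ n∸n≡0 (δ a b) ⟩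
    0                ∎)

  δ-injectiveˡ : ∀ {a b c} → δ a c ≡ δ b c → a ≡ b
  δ-injectiveˡ {a} {b} {c} eq = δ≡0⇒≡ (begin
    δ a b            ≡⟨ δ-∸ʳ (≤-reflexive (sym eq)) ⟩
    δ a c ∸ δ b c    ≡⟨ cong (_∸ δ b c) eq ⟩
    δ b c ∸ δ b c    ≡⟨ n∸n≡0 (δ b c) ⟩
    0                ∎)

  δ+δ<n⇒≡ : ∀ {a b} → δ a b + δ b a < n → a ≡ b
  δ+δ<n⇒≡ {a} {b} cycle<n = δ≡0⇒≡ (m+n≡0⇒m≡0 _ (trans (sym (δ-+ cycle<n)) (δ-self a)))

  -- The intervals {a+1, …, a+L} and {b+1, …, b+L} meet (cf. meet⇒δ<).
  Close : ℕ → Fin n → Fin n → Set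
  Close L a b = δ a b < L ⊎ δ b a < L

  Close? : ∀ L a b → Dec (Close L a b)
  Close? L a b = (δ a b <? L) ⊎-dec (δ b a <? L)

  Close-self⇒0< : ∀ {L a} → Close L a a → 0 < L
  Close-self⇒0< {L} {a} (inj₁ aa<L) = subst (_< L) (δ-self a) aa<L
  Close-self⇒0< {L} {a} (inj₂ aa<L) = subst (_< L) (δ-self a) aa<L

  Close-right : ∀ {L a b} → Close L a b → ¬ δ a b < L → δ b a < L
  Close-right (inj₁ ab<L) ¬ab<L = contradiction ab<L ¬ab<L
  Close-right (inj₂ ba<L) _     = ba<L

  Close-sym : ∀ {L a b} → Close L a b → Close L b a
  Close-sym = Sum.swap

  Close-mono : ∀ {L L' a b} → L ≤ L' → Close L a b → Close L' a b
  Close-mono L≤L' (inj₁ ab<L) = inj₁ (<-≤-trans ab<L L≤L')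
  Close-mono L≤L' (inj₂ ba<L) = inj₂ (<-≤-trans ba<L L≤L')

  Close-refl : ∀ {L} a → 0 < L → Close L a a
  Close-refl a 0<L = inj₁ (subst (_< _) (sym (δ-self a)) 0<L)

  Close-common-source : ∀ {L u a b} → δ u a < L → δ u b < L → Close L a b
  Close-common-source {u = u} {a} {b} ua<L ub<L with ≤-total (δ u a) (δ u b)
  ... | inj₁ ua≤ub = inj₁ (≤-<-trans (δ-∸ˡ-≤ ua≤ub) ub<L)
  ... | inj₂ ub≤ua = inj₂ (≤-<-trans (δ-∸ˡ-≤ ub≤ua) ua<L)

  Close-common-target : ∀ {L u a b} → δ a u < L → δ b u < L → Close L a b
  Close-common-target {u = u} {a} {b} au<L bu<L with ≤-total (δ b u) (δ a u)
  ... | inj₁ bu≤au = inj₁ (≤-<-trans (δ-∸ʳ-≤ bu≤au) au<L)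
  ... | inj₂ au≤bu = inj₂ (≤-<-trans (δ-∸ʳ-≤ au≤bu) bu<L)

  adjacent⇒¬Close : ∀ {ℓ a b} → δ b a ≡ ℓ → ℓ + ℓ ≤ n → ¬ Close ℓ a b
  adjacent⇒¬Close ba≡ℓ 2ℓ≤n (inj₂ ba<ℓ) = <-irrefl ba≡ℓ ba<ℓ
  adjacent⇒¬Close ba≡ℓ 2ℓ≤n (inj₁ ab<ℓ)
    with refl ← δ+δ<n⇒≡ (<-≤-trans (+-mono-<-≤ ab<ℓ (≤-reflexive ba≡ℓ)) 2ℓ≤n) = <-irrefl ba≡ℓ ab<ℓ

  δ≤∸ : ∀ {a b c : Fin n} {d e} → toℕ a + d ≈ toℕ c → toℕ b + e ≈ toℕ c → e ≤ d → δ a b ≤ d ∸ e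
  δ≤∸ {a} {b} {c} {d} {e} a+d≈c b+e≈c e≤d = δ≤ {a} {b} {d ∸ e} (≈-cancelʳ-+ e (begin
    (toℕ a + (d ∸ e) + e) % n    ≡⟨ cong (_% n) (+-assoc (toℕ a) _ e) ⟩
    (toℕ a + ((d ∸ e) + e)) % n  ≡⟨ cong (λ m → (toℕ a + m) % n) (m∸n+n≡m e≤d) ⟩
    (toℕ a + d) % n              ≡⟨ trans a+d≈c (sym b+e≈c) ⟩
    (toℕ b + e) % n              ∎))

  InInterval⇒≈ : ∀ {a s x} → InInterval n a s x → ∃ λ j → j < a × toℕ s + suc j ≈ toℕ x
  InInterval⇒≈ {x = x} (j , j<a , x≡) = j , j<a , trans (sym x≡) (sym (m<n⇒m%n≡m (toℕ<n x)))

  meet⇒δ< : ∀ {a s a' s'} → IntervalsMeet n a s a' s' → δ s s' < a ⊎ δ s' s < a'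
  meet⇒δ< (x , x∈ , x∈') with InInterval⇒≈ x∈ | InInterval⇒≈ x∈'
  ... | j , j<a , s+j≈x | j' , j'<a' , s'+j'≈x with ≤-total j' j
  ...   | inj₁ j'≤j = inj₁ (≤-<-trans (δ≤∸ s+j≈x s'+j'≈x (s≤s j'≤j)) (≤-<-trans (m∸n≤m j j') j<a))
  ...   | inj₂ j≤j' = inj₂ (≤-<-trans (δ≤∸ s'+j'≈x s+j≈x (s≤s j≤j')) (≤-<-trans (m∸n≤m j' j) j'<a'))

  meet-common⇒Close : ∀ {a c t₁ t₂ u} → IntervalsMeet n a t₁ c u → IntervalsMeet n a t₂ c u →
                      Close (a + c) t₁ t₂
  meet-common⇒Close {a} {c} {t₁} {t₂} {u} meet₁ meet₂ with meet⇒δ< meet₁ | meet⇒δ< meet₂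
  ... | inj₁ t₁u<a | inj₁ t₂u<a = Close-mono (m≤m+n a c) (Close-common-target t₁u<a t₂u<a)
  ... | inj₁ t₁u<a | inj₂ ut₂<c = inj₁ (≤-<-trans (δ-triangle t₁ u t₂) (+-mono-< t₁u<a ut₂<c))
  ... | inj₂ ut₁<c | inj₁ t₂u<a = inj₂ (≤-<-trans (δ-triangle t₂ u t₁) (+-mono-< t₂u<a ut₁<c))
  ... | inj₂ ut₁<c | inj₂ ut₂<c = Close-mono (m≤n+m c a) (Close-common-source ut₁<c ut₂<c)

  Close-to-length≤ : ∀ {L p ts} → Unique ts → (∀ {t} → t ∈ ts → Close L p t) → length ts ≤ L + L
  Close-to-length≤ {L} {p} unique close =
    length≤-by-piecewise-injection unique (λ t → δ p t <? L) (δ p) (λ t → L + δ t p)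
      (λ _ pt<L → <-≤-trans pt<L (m≤m+n L L))
      (λ t∈ ¬pt<L → +-monoʳ-< L (Close-right (close t∈) ¬pt<L))
      (λ _ _ _ _ → δ-injectiveʳ)
      (λ _ _ _ _ eq → δ-injectiveˡ (+-cancelˡ-≡ L _ _ eq))
      (λ _ _ px<L _ eq → <⇒≱ px<L (subst (L ≤_) (sym eq) (m≤m+n L _)))

  pairwise-Close-length≤-double : ∀ {L ts} → Unique ts → (∀ {x y} → x ∈ ts → y ∈ ts → Close L x y) →
                                  length ts ≤ L + L
  pairwise-Close-length≤-double {ts = []}    _      _     = z≤n
  pairwise-Close-length≤-double {ts = _ ∷ _} unique close = Close-to-length≤ unique (close (here refl))

  -- t ↦ δ p t on one side of p and t ↦ ℓ ∸ δ t p on the other; a collision would be a pair at distance ℓ.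
  Close-to-length≤-without-adjacent : ∀ {ℓ p ts} → ℓ < n → Unique ts → (∀ {t} → t ∈ ts → Close ℓ p t) →
                                      (∀ {x y} → x ∈ ts → y ∈ ts → δ x y ≢ ℓ) → length ts ≤ ℓ
  Close-to-length≤-without-adjacent {ℓ} {p} {ts} ℓ<n unique close no-adjacent =
    length≤-by-piecewise-injection unique (λ t → δ p t <? ℓ) (δ p) (λ t → ℓ ∸ δ t p)
      (λ _ pt<ℓ → pt<ℓ)
      (λ t∈ ¬pt<ℓ → ∸-monoʳ-< (0<δ t∈ ¬pt<ℓ) (<⇒≤ (tp<ℓ t∈ ¬pt<ℓ)))
      (λ _ _ _ _ → δ-injectiveʳ)
      (λ x∈ y∈ ¬px<ℓ ¬py<ℓ eq → δ-injectiveˡ (∸-cancelˡ-≡ (<⇒≤ (tp<ℓ x∈ ¬px<ℓ)) (<⇒≤ (tp<ℓ y∈ ¬py<ℓ)) eq))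
      (λ x∈ y∈ px<ℓ ¬py<ℓ eq → no-adjacent y∈ x∈ (yx≡ℓ y∈ ¬py<ℓ eq))
    where
    tp<ℓ : ∀ {t} → t ∈ ts → ¬ δ p t < ℓ → δ t p < ℓ
    tp<ℓ t∈ = Close-right (close t∈)
    t≢p : ∀ {t} → t ∈ ts → ¬ δ p t < ℓ → t ≢ p
    t≢p t∈ ¬pt<ℓ refl = ¬pt<ℓ (tp<ℓ t∈ ¬pt<ℓ)
    0<δ : ∀ {t} → t ∈ ts → ¬ δ p t < ℓ → 0 < δ t p
    0<δ t∈ ¬pt<ℓ = n≢0⇒n>0 (t≢p t∈ ¬pt<ℓ ∘ δ≡0⇒≡)
    yx≡ℓ : ∀ {x y} → y ∈ ts → ¬ δ p y < ℓ → δ p x ≡ ℓ ∸ δ y p → δ y x ≡ ℓ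
    yx≡ℓ {x} {y} y∈ ¬py<ℓ px≡ = begin
      δ y x           ≡⟨ δ-+ (subst (_< n) (sym yp+px≡ℓ) ℓ<n) ⟩
      δ y p + δ p x   ≡⟨ yp+px≡ℓ ⟩
      ℓ               ∎
      where
      yp+px≡ℓ : δ y p + δ p x ≡ ℓ
      yp+px≡ℓ = trans (cong (δ y p +_) px≡) (m+[n∸m]≡n (<⇒≤ (tp<ℓ y∈ ¬py<ℓ)))

  pairwise-Close-length≤ : ∀ {ℓ ts} → ℓ + ℓ ≤ n → Unique ts →
                           (∀ {x y} → x ∈ ts → y ∈ ts → Close ℓ x y) → length ts ≤ ℓ
  pairwise-Close-length≤ {ts = []}     _    _      _     = z≤n
  pairwise-Close-length≤ {ℓ} {p ∷ ts} 2ℓ≤n unique close =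
    Close-to-length≤-without-adjacent ℓ<n unique (close (here refl))
      (λ x∈ y∈ xy≡ℓ → adjacent⇒¬Close xy≡ℓ 2ℓ≤n (close y∈ x∈))
    where
    ℓ<n : ℓ < n
    ℓ<n = <-≤-trans (m<m+n ℓ (Close-self⇒0< (close (here refl) (here refl)))) 2ℓ≤n

  -- When {y+1, …, y+ℓ} directly follows {x+1, …, x+ℓ}, every interval of length ℓ meeting both contains y+1.
  adjacent-Close⇒δ< : ∀ {ℓ t x y} → δ x y ≡ ℓ → ℓ + ℓ + ℓ ≤ n → Close ℓ t x → Close ℓ t y → δ t y < ℓ
  adjacent-Close⇒δ< _ _ _ (inj₁ ty<ℓ) = ty<ℓ
  adjacent-Close⇒δ< {ℓ} {t} {x} {y} xy≡ℓ 3ℓ≤n (inj₂ xt<ℓ) (inj₂ yt<ℓ) =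
    contradiction (subst (ℓ ≤_) (sym (trans (δ-+ xy+yt<n) (cong (_+ δ y t) xy≡ℓ))) (m≤m+n ℓ (δ y t))) (<⇒≱ xt<ℓ)
    where
    xy+yt<n : δ x y + δ y t < n
    xy+yt<n = <-≤-trans (+-mono-≤-< (≤-reflexive xy≡ℓ) yt<ℓ) (≤-trans (m≤m+n (ℓ + ℓ) ℓ) 3ℓ≤n)
  adjacent-Close⇒δ< {ℓ} {t} {x} {y} xy≡ℓ 3ℓ≤n (inj₁ tx<ℓ) (inj₂ yt<ℓ)
    = contradiction (subst (δ y t <_) ℓ≡0 yt<ℓ) n≮0
    where
    yx<2ℓ : δ y x < ℓ + ℓ
    yx<2ℓ = ≤-<-trans (δ-triangle y t x) (+-mono-< yt<ℓ tx<ℓ)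
    cycle<n : δ x y + δ y x < n
    cycle<n = <-≤-trans (+-mono-≤-< (≤-reflexive xy≡ℓ) yx<2ℓ) (≤-trans (≤-reflexive (sym (+-assoc ℓ ℓ ℓ))) 3ℓ≤n)
    ℓ≡0 : ℓ ≡ 0
    ℓ≡0 = trans (sym xy≡ℓ) (trans (cong (δ x) (sym (δ+δ<n⇒≡ cycle<n))) (δ-self x))

  common-Close-length< : ∀ {ℓ t₁ t₂ ts} → 0 < ℓ → ℓ + ℓ + ℓ ≤ n → ¬ Close ℓ t₁ t₂ → Unique ts →
                         (∀ {t} → t ∈ ts → Close ℓ t₁ t × Close ℓ t₂ t) → length ts < ℓ
  common-Close-length< {ℓ} {t₁} {t₂} {ts} 0<ℓ 3ℓ≤n separated unique close =
    Close-to-length≤-without-adjacent ℓ<n (All.tabulate t₁≢ ∷ unique) close₁ no-adjacent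
    where
    2ℓ≤n : ℓ + ℓ ≤ n
    2ℓ≤n = ≤-trans (m≤m+n (ℓ + ℓ) ℓ) 3ℓ≤n
    ℓ<n : ℓ < n
    ℓ<n = <-≤-trans (m<m+n ℓ 0<ℓ) 2ℓ≤n
    t₁≢ : ∀ {t} → t ∈ ts → t₁ ≢ t
    t₁≢ t∈ refl = separated (Close-sym (proj₂ (close t∈)))
    close₁ : ∀ {t} → t ∈ t₁ ∷ ts → Close ℓ t₁ t
    close₁ (here refl) = Close-refl t₁ 0<ℓ
    close₁ (there t∈)  = proj₁ (close t∈)
    no-adjacent : ∀ {x y} → x ∈ t₁ ∷ ts → y ∈ t₁ ∷ ts → δ x y ≢ ℓ
    no-adjacent (here refl) y∈          xy≡ℓ = adjacent⇒¬Close xy≡ℓ 2ℓ≤n (Close-sym (close₁ y∈))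
    no-adjacent (there x∈)  (here refl) xy≡ℓ = adjacent⇒¬Close xy≡ℓ 2ℓ≤n (close₁ (there x∈))
    no-adjacent {x} {y} (there x∈) (there y∈) xy≡ℓ =
      separated (Close-common-target (junction proj₁) (junction proj₂))
      where
      junction : ∀ {u} → (∀ {t} → Close ℓ t₁ t × Close ℓ t₂ t → Close ℓ u t) → δ u y < ℓ
      junction side = adjacent-Close⇒δ< xy≡ℓ 3ℓ≤n (side (close x∈)) (side (close y∈))

module RectangleFamily (n₁ n₂ : ℕ) .{{_ : NonZero n₁}} .{{_ : NonZero n₂}} where
  module I = Cyclic n₁
  module J = Cyclic n₂
  open Rows {Fin n₁} {Fin n₂} _≟ᶠ_

  RowWithFarPair : ℕ → List (Rect n₁ n₂) → Set
  RowWithFarPair L R = ∃ λ s → ∃₂ λ t₁ t₂ → (s , t₁) ∈ R × (s , t₂) ∈ R × ¬ J.Close L t₁ t₂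

  ColumnWithFarPair : ℕ → List (Rect n₁ n₂) → Set
  ColumnWithFarPair L R = ∃ λ u → ∃₂ λ x₁ x₂ → (x₁ , u) ∈ R × (x₂ , u) ∈ R × ¬ I.Close L x₁ x₂

  length≤-by-rows : ∀ {y} R → (∀ s → length (row s R) ≤ y) → length R ≤ y * n₁
  length≤-by-rows {y} R row≤y = begin
    length R                                    ≤⟨ length≤sum-rows R (λ _ → ∈-allFin _) ⟩
    sum (map (λ s → length (row s R)) (allFin n₁)) ≤⟨ sum-map-≤-* row≤y (allFin n₁) ⟩
    y * length (allFin n₁)                      ≡⟨ cong (y *_) (length-tabulate id) ⟩
    y * n₁                                      ∎
    where open ≤-Reasoning

  rows-Close⇒length≤ : ∀ {ℓ R} → ℓ + ℓ ≤ n₂ → Unique R →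
                       (∀ {s t t'} → (s , t) ∈ R → (s , t') ∈ R → J.Close ℓ t t') → length R ≤ ℓ * n₁
  rows-Close⇒length≤ {R = R} 2ℓ≤n₂ unique close = length≤-by-rows R λ s →
    J.pairwise-Close-length≤ 2ℓ≤n₂ (row-unique unique) (λ t∈ t'∈ → close (∈-row⁻ R t∈) (∈-row⁻ R t'∈))

  module _ (k ℓ : ℕ) (R : List (Rect n₁ n₂)) (R-unique : Unique R)
           (R-pi : ∀ {r r'} → r ∈ R → r' ∈ R → ProjIntersecting n₁ n₂ k ℓ r k ℓ r') where

    -- In a row whose I-interval misses that of s₀, every J-interval meets the disjoint J-intervals
    -- of t₁ and t₂, so the row has fewer than ℓ members; the at most 2k remaining rows have at most
    -- 2L members each, which the slack (L + L) * (k + k) ≤ n₁ absorbs.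
    RowWithFarPair⇒length≤ : ∀ {L} → 0 < ℓ → ℓ + ℓ + ℓ ≤ n₂ → (L + L) * (k + k) ≤ n₁ →
                             (∀ {s t t'} → (s , t) ∈ R → (s , t') ∈ R → J.Close L t t') →
                             RowWithFarPair ℓ R → length R ≤ ℓ * n₁
    RowWithFarPair⇒length≤ {L} 0<ℓ 3ℓ≤n₂ slack rows-close (s₀ , t₁ , t₂ , t₁∈ , t₂∈ , separated) = begin
      length R                                              ≤⟨ length≤sum-rows R (λ _ → ∈-allFin _) ⟩
      sum (map (λ s → length (row s R)) (allFin n₁))        ≤⟨ sum-map-≤-piecewise near? near-row far-row (allFin n₁) ⟩
      pred ℓ * length (allFin n₁) + (L + L) * length near-rows
        ≤⟨ +-mono-≤ (≤-reflexive (cong (pred ℓ *_) (length-tabulate id))) (*-monoʳ-≤ (L + L) near-rows≤) ⟩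
      pred ℓ * n₁ + (L + L) * (k + k)                       ≤⟨ +-monoʳ-≤ (pred ℓ * n₁) slack ⟩
      pred ℓ * n₁ + n₁                                      ≡⟨ +-comm (pred ℓ * n₁) n₁ ⟩
      suc (pred ℓ) * n₁                                     ≡⟨ cong (_* n₁) (suc-pred ℓ {{>-nonZero 0<ℓ}}) ⟩
      ℓ * n₁                                                ∎
      where
      open ≤-Reasoning
      near? : ∀ s → Dec (I.Close k s₀ s)
      near? = I.Close? k s₀
      near-rows : List (Fin n₁)
      near-rows = filter near? (allFin n₁)
      near-rows≤ : length near-rows ≤ k + k
      near-rows≤ = I.Close-to-length≤ (filter⁺ near? (allFin⁺ n₁)) (proj₂ ∘ ∈-filter⁻ near? {xs = allFin n₁})
      near-row : ∀ s → I.Close k s₀ s → length (row s R) ≤ pred ℓ + (L + L)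
      near-row s _ = ≤-trans (J.pairwise-Close-length≤-double (row-unique R-unique)
                               (λ t∈ t'∈ → rows-close (∈-row⁻ R t∈) (∈-row⁻ R t'∈))) (m≤n+m (L + L) (pred ℓ))
      J-Close : ∀ {s t₀ t} → ¬ I.Close k s₀ s → (s₀ , t₀) ∈ R → t ∈ row s R → J.Close ℓ t₀ t
      J-Close ¬near t₀∈ t∈ with R-pi t₀∈ (∈-row⁻ R t∈)
      ... | inj₁ I-meet = contradiction (I.meet⇒δ< I-meet) ¬near
      ... | inj₂ J-meet = J.meet⇒δ< J-meet
      far-row : ∀ s → ¬ I.Close k s₀ s → length (row s R) ≤ pred ℓ
      far-row s ¬near = <⇒≤pred (J.common-Close-length< 0<ℓ 3ℓ≤n₂ separated (row-unique R-unique)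
                                   (λ t∈ → J-Close ¬near t₁∈ t∈ , J-Close ¬near t₂∈ t∈))

    length≤-or-RowWithFarPair : ∀ L → 0 < ℓ → ℓ + ℓ + ℓ ≤ n₂ → (L + L) * (k + k) ≤ n₁ →
                                length R ≤ ℓ * n₁ ⊎ RowWithFarPair L R
    length≤-or-RowWithFarPair L 0<ℓ 3ℓ≤n₂ slack with sameRow-or-counterexample (J.Close? L) R
    ... | inj₂ far = inj₂ far
    ... | inj₁ rows-close with sameRow-or-counterexample (J.Close? ℓ) R
    ...   | inj₁ rows-closeℓ = inj₁ (rows-Close⇒length≤ (≤-trans (m≤m+n (ℓ + ℓ) ℓ) 3ℓ≤n₂) R-unique rows-closeℓ)
    ...   | inj₂ separated   = inj₁ (RowWithFarPair⇒length≤ 0<ℓ 3ℓ≤n₂ slack rows-close separated)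

  far-row-and-far-column-clash :
    ∀ {k ℓ k' ℓ' R R'} → (∀ {r r'} → r ∈ R → r' ∈ R' → ProjIntersecting n₁ n₂ k ℓ r k' ℓ' r') →
    RowWithFarPair (ℓ + ℓ') R → ¬ ColumnWithFarPair (k' + k) R'
  far-row-and-far-column-clash {k} {ℓ} {k'} {ℓ'} {R' = R'} pi
    (s , t₁ , t₂ , t₁∈ , t₂∈ , far-row) (u , x₁ , x₂ , x₁∈ , x₂∈ , far-column) =
    far-column (I.meet-common⇒Close (I-meet x₁∈) (I-meet x₂∈))
    where
    I-meet : ∀ {x} → (x , u) ∈ R' → IntervalsMeet n₁ k' x k s
    I-meet x∈ with pi t₁∈ x∈ | pi t₂∈ x∈
    ... | inj₁ meet | _          = IntervalsMeet-sym meet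
    ... | inj₂ _    | inj₁ meet  = IntervalsMeet-sym meet
    ... | inj₂ meet₁ | inj₂ meet₂ = contradiction (J.meet-common⇒Close meet₁ meet₂) far-row

∈-map-swap⁻ : ∀ {A B : Set} {r : B × A} xs → r ∈ map swap xs → swap r ∈ xs
∈-map-swap⁻ xs r∈ with ∈-map⁻ swap r∈
... | _ , x∈ , refl = x∈

module _ {n₁ n₂ : ℕ} .{{_ : NonZero n₁}} .{{_ : NonZero n₂}} {R : List (Rect n₁ n₂)} where
  open RectangleFamily

  transpose-unique : Unique R → Unique (map swap R)
  transpose-unique = map⁺ (cong swap)

  transpose-pi : ∀ {k ℓ} → (∀ {r r'} → r ∈ R → r' ∈ R → ProjIntersecting n₁ n₂ k ℓ r k ℓ r') →
                 ∀ {r r'} → r ∈ map swap R → r' ∈ map swap R → ProjIntersecting n₂ n₁ ℓ k r ℓ k r'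
  transpose-pi pi r∈ r'∈ = Sum.swap (pi (∈-map-swap⁻ R r∈) (∈-map-swap⁻ R r'∈))

  transpose-RowWithFarPair : ∀ {L} → RowWithFarPair n₂ n₁ L (map swap R) → ColumnWithFarPair n₁ n₂ L R
  transpose-RowWithFarPair (u , x₁ , x₂ , x₁∈ , x₂∈ , far) =
    u , x₁ , x₂ , ∈-map-swap⁻ R x₁∈ , ∈-map-swap⁻ R x₂∈ , far

x+x+x≤n : ∀ {x b n} → x ≤ b → 1 ≤ b → 9 * (b * b) < n → x + x + x ≤ n
x+x+x≤n {x} {b} {n} x≤b 1≤b 9b²<n = begin
  x + x + x     ≤⟨ +-mono-≤ (+-mono-≤ x≤b x≤b) x≤b ⟩
  b + b + b     ≡⟨ solve 1 (λ b → b :+ b :+ b := con 3 :* b) refl b ⟩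
  3 * b         ≤⟨ *-monoʳ-≤ 3 (subst (_≤ b * b) (*-identityʳ b) (*-monoʳ-≤ b 1≤b)) ⟩
  3 * (b * b)   ≤⟨ *-monoˡ-≤ (b * b) {3} {9} (s≤s (s≤s (s≤s z≤n))) ⟩
  9 * (b * b)   <⟨ 9b²<n ⟩
  n             ∎
  where
  open ≤-Reasoning
  open +-*-Solver

[x+y+[x+y]]*[z+z]≤n : ∀ {x y z b n} → x ≤ b → y ≤ b → z ≤ b → 9 * (b * b) < n →
                      (x + y + (x + y)) * (z + z) ≤ n
[x+y+[x+y]]*[z+z]≤n {x} {y} {z} {b} {n} x≤b y≤b z≤b 9b²<n = begin
  (x + y + (x + y)) * (z + z)   ≤⟨ *-mono-≤ (+-mono-≤ x+y≤ x+y≤) (+-mono-≤ z≤b z≤b) ⟩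
  (b + b + (b + b)) * (b + b)   ≡⟨ solve 1 (λ b → (b :+ b :+ (b :+ b)) :* (b :+ b) := con 8 :* (b :* b)) refl b ⟩
  8 * (b * b)                   ≤⟨ *-monoˡ-≤ (b * b) {8} {9} (n≤1+n 8) ⟩
  9 * (b * b)                   <⟨ 9b²<n ⟩
  n                             ∎
  where
  open ≤-Reasoning
  open +-*-Solver
  x+y≤ : x + y ≤ b + b
  x+y≤ = +-mono-≤ x≤b y≤b

lemma9 : (m b n₁ n₂ : ℕ) .{{_ : NonZero n₁}} .{{_ : NonZero n₂}} →
         1 ≤ m → 1 ≤ b →
         (k ℓ : Fin m → ℕ) →
         (∀ i → 1 ≤ k i) → (∀ i → 1 ≤ ℓ i) →
         (∀ i → k i ≤ b) → (∀ i → ℓ i ≤ b) →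
         9 * (b * b) < n₁ → 9 * (b * b) < n₂ →
         (R : Fin m → List (Rect n₁ n₂)) →
         (∀ i → Unique (R i)) →
         (∀ i j (r r' : Rect n₁ n₂) → r ∈ R i → r' ∈ R j →
           ProjIntersecting n₁ n₂ (k i) (ℓ i) r (k j) (ℓ j) r') →
         (∀ i → length (R i) ≤ ℓ i * n₁) ⊎ (∀ i → length (R i) ≤ k i * n₂)
lemma9 m b n₁ n₂ _ 1≤b k ℓ 1≤k 1≤ℓ k≤b ℓ≤b 9b²<n₁ 9b²<n₂ R R-unique R-pi
  with all? (λ i → length (R i) ≤? ℓ i * n₁) | all? (λ i → length (R i) ≤? k i * n₂)
... | yes short₁ | _          = inj₁ short₁
... | no _       | yes short₂ = inj₂ short₂
... | no ¬short₁ | no ¬short₂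
  with i , long₁ ← ¬∀⟶∃¬ m _ (λ i → length (R i) ≤? ℓ i * n₁) ¬short₁
     | j , long₂ ← ¬∀⟶∃¬ m _ (λ j → length (R j) ≤? k j * n₂) ¬short₂
  = contradiction (transpose-RowWithFarPair far-column)
                  (far-row-and-far-column-clash n₁ n₂ (λ {r} {r'} → R-pi i j r r') far-row)
  where
  open RectangleFamily
  far-row : RowWithFarPair n₁ n₂ (ℓ i + ℓ j) (R i)
  far-row = Sum.[ flip contradiction long₁ , id ]′
    (length≤-or-RowWithFarPair n₁ n₂ (k i) (ℓ i) (R i) (R-unique i) (λ {r} {r'} → R-pi i i r r')
      (ℓ i + ℓ j) (1≤ℓ i) (x+x+x≤n (ℓ≤b i) 1≤b 9b²<n₂) ([x+y+[x+y]]*[z+z]≤n (ℓ≤b i) (ℓ≤b j) (k≤b i) 9b²<n₁))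
  far-column : RowWithFarPair n₂ n₁ (k j + k i) (map swap (R j))
  far-column = Sum.[ flip contradiction long₂ ∘ subst (_≤ k j * n₂) (length-map swap (R j)) , id ]′
    (length≤-or-RowWithFarPair n₂ n₁ (ℓ j) (k j) (map swap (R j)) (transpose-unique (R-unique j))
      (transpose-pi (λ {r} {r'} → R-pi j j r r'))
      (k j + k i) (1≤k j) (x+x+x≤n (k≤b j) 1≤b 9b²<n₁) ([x+y+[x+y]]*[z+z]≤n (k≤b j) (k≤b i) (ℓ≤b j) 9b²<n₂))
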